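{- Let $G = Z_{15}\times Z_{82}$ with multiplication $[x,y][u,v] = [x+u \bmod 15,\; y\cdot 37^{u} + v \bmod 82]$ (a group of order $1230$). Let $S=\{g,g^{ -1} : g\in\{[7,60],[4,30],[3,37]\}\}$. Then $S$ consists of exactly $6$ non-identity elements and the Cayley graph $\mathrm{Cay}(G,S)$ is a connected $6$-regular graph of diameter $5$ on $1230$ vertices.
   Context: For a finite group $G$ and an inverse-closed subset $S\subseteq G$ not containing the identity, the Cayley graph $\mathrm{Cay}(G,S)$ is the undirected graph with vertex set $G$ in which $x$ and $y$ are adjacent iff $y=xs$ for some $s\in S$; it is $|S|$-regular. The diameter of a connected graph is the maximum over all pairs of vertices of the length of a shortest path between them. For integers $m,n$ and a unit $a$ of $Z_n$ whose multiplicative order divides $m$, the group $m\times_a n$ is the set $Z_m\times Z_n$ with multiplication $[x,y][u,v]=[x+u \bmod m,\; y a^u+v \bmod n]$. -}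

module Defs where

open import Data.Nat using (ℕ; zero; suc; _+_; _*_; _^_)
open import Data.Nat.DivMod using (_mod_)
open import Data.Fin using (Fin; toℕ; #_)
open import Data.Product using (Σ; ∃; _×_; _,_)
open import Data.Sum using (_⊎_)
open import Data.List using (List; _∷_; [])
open import Data.List.Membership.Propositional using (_∈_)
open import Relation.Binary.PropositionalEquality using (_≡_)
open import Function.Definitions using (Injective)

G : Set
G = Fin 15 × Fin 82

_·_ : G → G → G
(x , y) · (u , v) = ((toℕ x + toℕ u) mod 15) , ((toℕ y * 37 ^ toℕ u + toℕ v) mod 82)

e : G
e = (# 0 , # 0)

gens : List G
gens = (# 7 , # 60) ∷ (# 4 , # 30) ∷ (# 3 , # 37) ∷ []

-- S = { g, g⁻¹ : g ∈ gens };  s = g⁻¹ is expressed as s · g ≡ e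
InS : G → Set
InS s = Σ G λ g → g ∈ gens × (s ≡ g ⊎ s · g ≡ e)

Adj : G → G → Set
Adj x y = Σ G λ s → InS s × y ≡ x · s

data Reach : ℕ → G → G → Set where
  here : ∀ {n x} → Reach n x x
  step : ∀ {n x y z} → Adj x y → Reach n y z → Reach (suc n) x z

HasExactly : ℕ → (G → Set) → Set
HasExactly k P = Σ (Fin k → G) λ f → Injective _≡_ _≡_ f × (∀ a → P a → ∃ λ i → f i ≡ a) × (∀ i → P (f i))

{-# OPTIONS --safe #-}
module Submission where

-- The multiplication of m ×_a n satisfies the group laws as soon as a ^ m ≡ 1 (mod n):
-- the only non-trivial law is associativity, where a ^ (u + p) has to be compared with
-- a ^ ((u + p) mod m), and that is exactly what a ^ m ≡ 1 allows. Left multiplication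
-- preserves adjacency, so every distance in the Cayley graph is a distance to e; these
-- are computed by a breadth-first search whose radius-5 ball around e is all of G,
-- while (5, 0) lies outside the radius-4 ball.

open import Algebra.Bundles using (Group)
open import Algebra.Consequences.Propositional using (assoc∧id∧invʳ⇒invˡ-unique)
open import Algebra.Core using (Op₁; Op₂)
open import Algebra.Structures using (IsGroup)
open import Data.Bool using (Bool; T)
open import Data.Fin as Fin using (Fin; #_; toℕ; splitAt; join)
open import Data.Fin.Properties
  using (toℕ-injective; toℕ-fromℕ<; toℕ<n; fromℕ<-cong; splitAt-join; *↔×; all?; any?)
open import Data.List as List using ()
open import Data.List.Membership.Propositional.Properties using (∈-lookup)
open import Data.List.Relation.Unary.Any using (index)
open import Data.List.Relation.Unary.Any.Properties using (lookup-index)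
open import Data.Nat using (ℕ; zero; suc; _≤_; s≤s; _+_; _*_; _^_; _∸_; _%_; _/_; NonZero; >-nonZero⁻¹)
open import Data.Nat.DivMod
  using (_mod_; m%n%n≡m%n; %-distribˡ-+; %-distribˡ-*; m<n⇒m%n≡m; m≡m%n+[m/n]*n; m%n<n; [m+n]%n≡m%n; m%n≤n)
open import Data.Nat.Properties
  using (n≤1+n; +-assoc; *-comm; +-identityʳ; *-identityʳ; ^-distribˡ-+-*; ^-*-assoc; m+[n∸m]≡n)
open import Data.Nat.Tactic.RingSolver using (solve-∀)
open import Data.Product using (_×_; _,_; ∃)
open import Data.Product.Properties using (≡-dec)
open import Data.Sum using (_⊎_; inj₁; inj₂)
open import Data.Vec using (Vec; tabulate; lookup)
open import Data.Vec.Properties using (lookup∘tabulate)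
open import Function.Base using (_∘_)
open import Function.Bundles using (_↔_)
open import Function.Definitions using (Injective)
open import Function.Properties.Inverse using (↔-sym)
open import Level using (0ℓ)
open import Relation.Binary.Bundles using (Setoid)
open import Relation.Binary.Construct.On as On using ()
open import Relation.Binary.Definitions using (DecidableEquality)
open import Relation.Binary.PropositionalEquality
import Relation.Binary.Reasoning.Setoid as SetoidReasoning
open import Relation.Nullary using (¬_; Dec; map′; ¬?; _→-dec_; _⊎-dec_; T?)
open import Relation.Nullary.Decidable using (⌊_⌋; from-yes; toWitness; fromWitness)
open import Relation.Unary using (Decidable)

open import Defs

module ModularArithmetic (d : ℕ) .{{_ : NonZero d}} where

  infix 4 _≈_
  _≈_ : ℕ → ℕ → Set
  k ≈ l = k % d ≡ l % d

  ≈-setoid : Setoid 0ℓ 0ℓ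
  ≈-setoid = On.setoid (setoid ℕ) (_% d)

  open Setoid ≈-setoid public using () renaming (refl to ≈-refl; sym to ≈-sym)

  %-≈ : ∀ k → k % d ≈ k
  %-≈ k = m%n%n≡m%n k d

  toℕ-mod-≈ : ∀ k → toℕ (k mod d) ≈ k
  toℕ-mod-≈ k = trans (cong (_% d) (toℕ-fromℕ< _)) (%-≈ k)

  toℕ-0-mod : toℕ (0 mod d) ≡ 0
  toℕ-0-mod = trans (toℕ-fromℕ< _) (m<n⇒m%n≡m (>-nonZero⁻¹ d))

  ≈⇒mod-≡ : ∀ {k l} → k ≈ l → k mod d ≡ l mod d
  ≈⇒mod-≡ {k} {l} k≈l = fromℕ<-cong (k % d) (l % d) k≈l _ _

  mod-toℕ : ∀ (i : Fin d) → toℕ i mod d ≡ i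
  mod-toℕ i = toℕ-injective (trans (toℕ-fromℕ< _) (m<n⇒m%n≡m (toℕ<n i)))

  +-cong : ∀ {k k′ l l′} → k ≈ k′ → l ≈ l′ → k + l ≈ k′ + l′
  +-cong {k} {k′} {l} {l′} k≈k′ l≈l′ = begin
    (k + l) % d            ≡⟨ %-distribˡ-+ k l d ⟩
    (k % d + l % d) % d    ≡⟨ cong₂ (λ x y → (x + y) % d) k≈k′ l≈l′ ⟩
    (k′ % d + l′ % d) % d  ≡⟨ %-distribˡ-+ k′ l′ d ⟨
    (k′ + l′) % d          ∎
    where open ≡-Reasoning

  *-cong : ∀ {k k′ l l′} → k ≈ k′ → l ≈ l′ → k * l ≈ k′ * l′
  *-cong {k} {k′} {l} {l′} k≈k′ l≈l′ = begin
    (k * l) % d            ≡⟨ %-distribˡ-* k l d ⟩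
    (k % d * (l % d)) % d  ≡⟨ cong₂ (λ x y → (x * y) % d) k≈k′ l≈l′ ⟩
    (k′ % d * (l′ % d)) % d ≡⟨ %-distribˡ-* k′ l′ d ⟨
    (k′ * l′) % d          ∎
    where open ≡-Reasoning

  ≈1⇒^≈1 : ∀ {b} → b ≈ 1 → ∀ k → b ^ k ≈ 1
  ≈1⇒^≈1 b≈1 zero    = refl
  ≈1⇒^≈1 b≈1 (suc k) = *-cong b≈1 (≈1⇒^≈1 b≈1 k)

  negate : ℕ → Fin d
  negate k = (d ∸ k % d) mod d

  +-negate≈0 : ∀ k → k + toℕ (negate k) ≈ 0
  +-negate≈0 k = begin
    k + toℕ (negate k)  ≈⟨ +-cong (≈-sym (%-≈ k)) (toℕ-mod-≈ (d ∸ k % d)) ⟩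
    k % d + (d ∸ k % d) ≡⟨ m+[n∸m]≡n (m%n≤n k d) ⟩
    d                   ≈⟨ [m+n]%n≡m%n 0 d ⟩
    0                   ∎
    where open SetoidReasoning ≈-setoid

^-periodic : ∀ a m n .{{_ : NonZero m}} .{{_ : NonZero n}} → let open ModularArithmetic n in
             a ^ m ≈ 1 → ∀ k → a ^ (k % m) ≈ a ^ k
^-periodic a m n aᵐ≈1 k = begin
  a ^ (k % m)                     ≡⟨ *-identityʳ _ ⟨
  a ^ (k % m) * 1                 ≈⟨ *-cong {a ^ (k % m)} ≈-refl (≈-sym (≈1⇒^≈1 aᵐ≈1 (k / m))) ⟩
  a ^ (k % m) * (a ^ m) ^ (k / m) ≡⟨ cong (a ^ (k % m) *_) (^-*-assoc a m (k / m)) ⟩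
  a ^ (k % m) * a ^ (m * (k / m)) ≡⟨ ^-distribˡ-+-* a (k % m) (m * (k / m)) ⟨
  a ^ (k % m + m * (k / m))       ≡⟨ cong (λ t → a ^ (k % m + t)) (*-comm m (k / m)) ⟩
  a ^ (k % m + k / m * m)         ≡⟨ cong (a ^_) (m≡m%n+[m/n]*n k m) ⟨
  a ^ k                           ∎
  where
  open ModularArithmetic n
  open SetoidReasoning ≈-setoid

[yb+v]c+q≡y[bc]+[vc+q] : ∀ y v q b c → (y * b + v) * c + q ≡ y * (b * c) + (v * c + q)
[yb+v]c+q≡y[bc]+[vc+q] = solve-∀

module SemidirectProduct (m n a : ℕ) .{{m≢0 : NonZero m}} .{{n≢0 : NonZero n}}
                         (aᵐ≡1 : a ^ m % n ≡ 1 % n) where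

  private
    module M = ModularArithmetic m {{m≢0}}
    module N = ModularArithmetic n {{n≢0}}

  Carrier : Set
  Carrier = Fin m × Fin n

  infixl 7 _∙_
  _∙_ : Op₂ Carrier
  (x , y) ∙ (u , v) = (toℕ x + toℕ u) mod m , (toℕ y * a ^ toℕ u + toℕ v) mod n

  ε : Carrier
  ε = 0 mod m , 0 mod n

  infix 25 _⁻¹
  _⁻¹ : Op₁ Carrier
  (x , y) ⁻¹ = x′ , N.negate (toℕ y * a ^ toℕ x′)
    where x′ = M.negate (toℕ x)

  assoc : ∀ g h k → (g ∙ h) ∙ k ≡ g ∙ (h ∙ k)
  assoc (x , y) (u , v) (p , q) = cong₂ _,_ (M.≈⇒mod-≡ first) (N.≈⇒mod-≡ second)
    where
    X = toℕ x
    Y = toℕ y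
    U = toℕ u
    V = toℕ v
    P = toℕ p
    Q = toℕ q

    first : toℕ ((X + U) mod m) + P M.≈ X + toℕ ((U + P) mod m)
    first = begin
      toℕ ((X + U) mod m) + P ≈⟨ M.+-cong (M.toℕ-mod-≈ (X + U)) M.≈-refl ⟩
      X + U + P               ≡⟨ +-assoc X U P ⟩
      X + (U + P)             ≈⟨ M.+-cong {X} M.≈-refl (M.≈-sym (M.toℕ-mod-≈ (U + P))) ⟩
      X + toℕ ((U + P) mod m) ∎
      where open SetoidReasoning M.≈-setoid

    second : toℕ ((Y * a ^ U + V) mod n) * a ^ P + Q
             N.≈ Y * a ^ toℕ ((U + P) mod m) + toℕ ((V * a ^ P + Q) mod n)
    second = begin
      toℕ ((Y * a ^ U + V) mod n) * a ^ P + Q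
        ≈⟨ N.+-cong (N.*-cong (N.toℕ-mod-≈ (Y * a ^ U + V)) N.≈-refl) N.≈-refl ⟩
      (Y * a ^ U + V) * a ^ P + Q
        ≡⟨ [yb+v]c+q≡y[bc]+[vc+q] Y V Q (a ^ U) (a ^ P) ⟩
      Y * (a ^ U * a ^ P) + (V * a ^ P + Q)
        ≡⟨ cong (λ t → Y * t + (V * a ^ P + Q)) (^-distribˡ-+-* a U P) ⟨
      Y * a ^ (U + P) + (V * a ^ P + Q)
        ≈⟨ N.+-cong (N.*-cong {Y} N.≈-refl (N.≈-sym (^-periodic a m n aᵐ≡1 (U + P))))
                    (N.≈-sym (N.toℕ-mod-≈ (V * a ^ P + Q))) ⟩
      Y * a ^ ((U + P) % m) + toℕ ((V * a ^ P + Q) mod n)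
        ≡⟨ cong (λ t → Y * a ^ t + toℕ ((V * a ^ P + Q) mod n)) (toℕ-fromℕ< (m%n<n (U + P) m)) ⟨
      Y * a ^ toℕ ((U + P) mod m) + toℕ ((V * a ^ P + Q) mod n)
        ∎
      where open SetoidReasoning N.≈-setoid

  identityˡ : ∀ g → ε ∙ g ≡ g
  identityˡ (u , v) rewrite M.toℕ-0-mod | N.toℕ-0-mod = cong₂ _,_ (M.mod-toℕ u) (N.mod-toℕ v)

  identityʳ : ∀ g → g ∙ ε ≡ g
  identityʳ (x , y) rewrite M.toℕ-0-mod | N.toℕ-0-mod = cong₂ _,_
    (trans (cong (_mod m) (+-identityʳ (toℕ x))) (M.mod-toℕ x))
    (trans (cong (_mod n) (trans (+-identityʳ _) (*-identityʳ (toℕ y)))) (N.mod-toℕ y))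

  inverseʳ : ∀ g → g ∙ g ⁻¹ ≡ ε
  inverseʳ (x , y) = cong₂ _,_ (M.≈⇒mod-≡ (M.+-negate≈0 (toℕ x))) (N.≈⇒mod-≡ (N.+-negate≈0 _))

  inverseˡ : ∀ g → g ⁻¹ ∙ g ≡ ε
  inverseˡ g = begin
    g ⁻¹ ∙ g          ≡⟨ cong (g ⁻¹ ∙_) g≡g⁻¹⁻¹ ⟩
    g ⁻¹ ∙ (g ⁻¹) ⁻¹  ≡⟨ inverseʳ (g ⁻¹) ⟩
    ε                 ∎
    where
    open ≡-Reasoning
    g≡g⁻¹⁻¹ : g ≡ (g ⁻¹) ⁻¹
    g≡g⁻¹⁻¹ = assoc∧id∧invʳ⇒invˡ-unique {_∙_ = _∙_} {_⁻¹} {ε}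
                assoc (identityˡ , identityʳ) inverseʳ g (g ⁻¹) (inverseʳ g)

  isGroup : IsGroup _≡_ _∙_ ε _⁻¹
  isGroup = record
    { isMonoid = record
      { isSemigroup = record
        { isMagma = record { isEquivalence = isEquivalence ; ∙-cong = cong₂ _∙_ }
        ; assoc = assoc
        }
      ; identity = identityˡ , identityʳ
      }
    ; inverse = inverseˡ , inverseʳ
    ; ⁻¹-cong = cong _⁻¹
    }

open SemidirectProduct 15 82 37 refl using (_⁻¹)

·-isGroup : IsGroup _≡_ _·_ e _⁻¹
·-isGroup = SemidirectProduct.isGroup 15 82 37 refl

·-group : Group 0ℓ 0ℓ
·-group = record { isGroup = ·-isGroup }

open Group ·-group using (assoc; inverseˡ; identityʳ)
open import Algebra.Properties.Group ·-group using (∙-cancelˡ; inverseˡ-unique; \\-leftDividesˡ)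

_≟G_ : DecidableEquality G
_≟G_ = ≡-dec Fin._≟_ Fin._≟_

∀G? : ∀ {p} {P : G → Set p} → Decidable P → Dec (∀ g → P g)
∀G? P? = map′ (λ ∀xy (x , y) → ∀xy x y) (λ ∀g x y → ∀g (x , y)) (all? λ x → all? λ y → P? (x , y))

generator : Fin 3 → G
generator = List.lookup gens

signedGenerator : Fin 3 ⊎ Fin 3 → G
signedGenerator (inj₁ j) = generator j
signedGenerator (inj₂ j) = generator j ⁻¹

signedGenerator-∈S : ∀ k → InS (signedGenerator k)
signedGenerator-∈S (inj₁ j) = generator j , ∈-lookup j , inj₁ refl
signedGenerator-∈S (inj₂ j) = generator j , ∈-lookup j , inj₂ (inverseˡ (generator j))

connection : Fin 6 → G
connection i = signedGenerator (splitAt 3 i)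

connection-∈S : ∀ i → InS (connection i)
connection-∈S i = signedGenerator-∈S (splitAt 3 i)

connection-join : ∀ k → connection (join 3 3 k) ≡ signedGenerator k
connection-join k = cong signedGenerator (splitAt-join 3 3 k)

connection-onto-S : ∀ s → InS s → ∃ λ i → connection i ≡ s
connection-onto-S s (g , g∈gens , inj₁ s≡g) = join 3 3 (inj₁ (index g∈gens)) , (begin
  connection (join 3 3 (inj₁ (index g∈gens))) ≡⟨ connection-join (inj₁ (index g∈gens)) ⟩
  generator (index g∈gens)                     ≡⟨ lookup-index g∈gens ⟨
  g                                            ≡⟨ s≡g ⟨
  s                                            ∎)
  where open ≡-Reasoning
connection-onto-S s (g , g∈gens , inj₂ sg≡e) = join 3 3 (inj₂ (index g∈gens)) , (begin
  connection (join 3 3 (inj₂ (index g∈gens))) ≡⟨ connection-join (inj₂ (index g∈gens)) ⟩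
  generator (index g∈gens) ⁻¹                  ≡⟨ cong _⁻¹ (lookup-index g∈gens) ⟨
  g ⁻¹                                         ≡⟨ inverseˡ-unique s g sg≡e ⟨
  s                                            ∎)
  where open ≡-Reasoning

connection-injective : Injective _≡_ _≡_ connection
connection-injective {i} {j} = from-yes (all? λ i → all? λ j → connection i ≟G connection j →-dec i Fin.≟ j) i j

connection≢e : ∀ i → connection i ≢ e
connection≢e = from-yes (all? λ i → ¬? (connection i ≟G e))

Reach-mono : ∀ {m n x y} → m ≤ n → Reach m x y → Reach n x y
Reach-mono _         here         = here
Reach-mono (s≤s m≤n) (step adj r) = step adj (Reach-mono m≤n r)

Adj-translate : ∀ g {x y} → Adj x y → Adj (g · x) (g · y)
Adj-translate g {x} (s , s∈S , y≡xs) = s , s∈S , trans (cong (g ·_) y≡xs) (sym (assoc g x s))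

Reach-translate : ∀ g {n x y} → Reach n x y → Reach n (g · x) (g · y)
Reach-translate g here         = here
Reach-translate g (step adj r) = step (Adj-translate g adj) (Reach-translate g r)

Table : Set
Table = Vec (Vec Bool 82) 15

lookupG : Table → G → Bool
lookupG t (x , y) = lookup (lookup t x) y

-- Opaque so that conversion checking compares two symbolic tables through their
-- generating functions instead of unfolding all 1230 entries.
opaque
  tabulateG : (G → Bool) → Table
  tabulateG f = tabulate λ x → tabulate λ y → f (x , y)

  lookupG-tabulateG : ∀ f g → lookupG (tabulateG f) g ≡ f g
  lookupG-tabulateG f (x , y) = begin
    lookup (lookup (tabulateG f) x) y     ≡⟨ cong (λ row → lookup row y) (lookup∘tabulate (λ x → tabulate λ y → f (x , y)) x) ⟩
    lookup (tabulate (λ y → f (x , y))) y ≡⟨ lookup∘tabulate (λ y → f (x , y)) y ⟩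
    f (x , y)                             ∎
    where open ≡-Reasoning

tabulateDec : ∀ {P : G → Set} → Decidable P → Table
tabulateDec P? = tabulateG (⌊_⌋ ∘ P?)

tabulateDec-sound : ∀ {P : G → Set} (P? : Decidable P) g → T (lookupG (tabulateDec P?) g) → P g
tabulateDec-sound P? g p = toWitness {a? = P? g} (subst T (lookupG-tabulateG (⌊_⌋ ∘ P?) g) p)

tabulateDec-complete : ∀ {P : G → Set} (P? : Decidable P) {g} → P g → T (lookupG (tabulateDec P?) g)
tabulateDec-complete P? {g} p = subst T (sym (lookupG-tabulateG (⌊_⌋ ∘ P?) g)) (fromWitness {a? = P? g} p)

expand? : (t : Table) → Decidable λ x → T (lookupG t x) ⊎ ∃ λ i → T (lookupG t (x · connection i))
expand? t x = T? (lookupG t x) ⊎-dec any? λ i → T? (lookupG t (x · connection i))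

ball : ℕ → Table
ball zero    = tabulateDec (_≟G e)
ball (suc n) = tabulateDec (expand? (ball n))

ball-sound : ∀ n x → T (lookupG (ball n) x) → Reach n x e
ball-sound zero    x p with tabulateDec-sound (_≟G e) x p
... | refl = here
ball-sound (suc n) x p with tabulateDec-sound (expand? (ball n)) x p
... | inj₁ q       = Reach-mono (n≤1+n n) (ball-sound n x q)
... | inj₂ (i , q) = step (connection i , connection-∈S i , refl) (ball-sound n (x · connection i) q)

ball-complete : ∀ {n x} → Reach n x e → T (lookupG (ball n) x)
ball-complete {zero}  here = tabulateDec-complete (_≟G e) refl
ball-complete {suc n} here = tabulateDec-complete (expand? (ball n)) (inj₁ (ball-complete {n} here))
ball-complete {suc n} (step (s , s∈S , y≡xs) r) with connection-onto-S s s∈S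
... | i , refl = tabulateDec-complete (expand? (ball n))
                   (inj₂ (i , subst (T ∘ lookupG (ball n)) y≡xs (ball-complete r)))

far : G
far = # 5 , # 0

full? : (t : Table) → Dec (∀ g → T (lookupG t g))
full? t = ∀G? (T? ∘ lookupG t)

opaque
  unfolding tabulateG

  ball5-full : ∀ g → T (lookupG (ball 5) g)
  ball5-full = from-yes (full? (ball 5))

  far-not-in-ball4 : ¬ T (lookupG (ball 4) far)
  far-not-in-ball4 ()

diameter≤5 : ∀ x y → Reach 5 x y
diameter≤5 x y = subst₂ (Reach 5) (\\-leftDividesˡ y x) (identityʳ y)
  (Reach-translate y (ball-sound 5 (y ⁻¹ · x) (ball5-full (y ⁻¹ · x))))

far-not-within-4 : ¬ Reach 4 far e
far-not-within-4 r = far-not-in-ball4 (ball-complete r)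

S-hasExactly-6 : HasExactly 6 InS
S-hasExactly-6 = connection , connection-injective , connection-onto-S , connection-∈S

S-∌e : ∀ s → InS s → ¬ (s ≡ e)
S-∌e s s∈S s≡e with connection-onto-S s s∈S
... | i , cᵢ≡s = connection≢e i (trans cᵢ≡s s≡e)

Adj-hasExactly-6 : ∀ x → HasExactly 6 (Adj x)
Adj-hasExactly-6 x = (λ i → x · connection i)
                   , (λ {i} {j} eq → connection-injective (∙-cancelˡ x (connection i) (connection j) eq))
                   , neighbour-onto
                   , (λ i → connection i , connection-∈S i , refl)
  where
  neighbour-onto : ∀ y → Adj x y → ∃ λ i → x · connection i ≡ y
  neighbour-onto y (s , s∈S , y≡xs) with connection-onto-S s s∈S
  ... | i , cᵢ≡s = i , trans (cong (x ·_) cᵢ≡s) (sym y≡xs)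

mainTheorem5 : (HasExactly 6 InS × (∀ s → InS s → ¬ (s ≡ e)))
    × (G ↔ Fin 1230)
    × (∀ x y → ∃ λ n → Reach n x y)
    × (∀ x → HasExactly 6 (Adj x))
    × ((∀ x y → Reach 5 x y) × (∃ λ x → ∃ λ y → ¬ Reach 4 x y))
mainTheorem5 =
    (S-hasExactly-6 , S-∌e)
  , ↔-sym *↔×
  , (λ x y → 5 , diameter≤5 x y)
  , Adj-hasExactly-6
  , diameter≤5 , far , e , far-not-within-4
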